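{- For every $\ell\in[k]$, $(P^\ell,\mathcal M_\ell)$ is a matroid, where $\mathcal M_\ell\subseteq 2^{P^\ell}$ is the family of independent sets contained in $P^\ell$.
   Context: Let $p_1,\dots,p_n\in\{1,2,\dots\}$ be profits and $\gamma:2^{[n]}\to\mathbb Z_+$ a function with $\gamma(\emptyset)=0$ that is monotonically non-decreasing, submodular, and satisfies $\gamma(A\cup\{i\})-\gamma(A)\in\{0,p_i\}$ for all $i\in[n]$, $A\subseteq[n]$. A set $S\subseteq[n]$ is independent if $\gamma(S)=\sum_{i\in S}p_i$. The profit partition $(P^1,\dots,P^k)$ of $[n]$ is the partition such that all items in $P^\ell$ have the same profit $p^\ell$, with $0<p^1<\dots<p^k$. -}

module Defs where

open import Data.Nat using (ℕ; zero; suc; _+_; _≤_; _<_; _≟_)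
open import Data.Bool using (Bool; true; false; if_then_else_)
open import Data.Fin using (Fin; zero; suc)
open import Data.Fin.Subset using (Subset; ⊥; ⁅_⁆; _∈_; _∉_; _⊆_; _∪_; _∩_; ∣_∣)
open import Data.Vec using (Vec; []; _∷_; tabulate)
open import Data.Product using (Σ; ∃; _×_)
open import Data.Sum using (_⊎_)
open import Relation.Binary.PropositionalEquality using (_≡_)
open import Relation.Nullary using (does)

sumOver : ∀ {n} → (Fin n → ℕ) → Subset n → ℕ
sumOver {zero}  p []      = 0
sumOver {suc n} p (b ∷ S) =
  (if b then p zero else 0) + sumOver (λ i → p (suc i)) S

record IsProfitFunction {n : ℕ} (p : Fin n → ℕ) (γ : Subset n → ℕ) : Set where
  field
    profit-pos   : ∀ i → 1 ≤ p i
    γ-empty      : γ ⊥ ≡ 0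
    γ-monotone   : ∀ A B → A ⊆ B → γ A ≤ γ B
    γ-submodular : ∀ A B → γ (A ∪ B) + γ (A ∩ B) ≤ γ A + γ B
    γ-marginal   : ∀ i A → (γ (A ∪ ⁅ i ⁆) ≡ γ A + 0) ⊎ (γ (A ∪ ⁅ i ⁆) ≡ γ A + p i)

Independent : ∀ {n} → (Fin n → ℕ) → (Subset n → ℕ) → Subset n → Set
Independent p γ S = γ S ≡ sumOver p S

ProfitClass : ∀ {n} → (Fin n → ℕ) → ℕ → Subset n
ProfitClass p v = tabulate (λ i → does (p i ≟ v))

record IsMatroid {n : ℕ} (E : Subset n) (M : Subset n → Set) : Set where
  field
    within-ground : ∀ A → M A → A ⊆ E
    empty-indep   : M ⊥
    hereditary    : ∀ A B → A ⊆ B → M B → M A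
    augmentation  : ∀ A B → M A → M B → ∣ A ∣ < ∣ B ∣ →
                    ∃ λ x → x ∈ B × x ∉ A × M (A ∪ ⁅ x ⁆)

IndepIn : ∀ {n} → (Fin n → ℕ) → (Subset n → ℕ) → Subset n → Subset n → Set
IndepIn p γ E S = S ⊆ E × Independent p γ S

-- Within a profit class every item has the same profit v, so for subsets S of the class
-- Σ_S p = v ∣S∣ and the matroid axioms reduce to facts about γ.  Heredity: the deficit
-- Σ_S p ∸ γ S can only grow when S is enlarged, since γ gains at most p x per added item.
-- Augmentation: if no x ∈ B adds its full profit to γ A, then no x ∈ B increases γ A at all,
-- so by submodularity γ (A ∪ B) = γ A, whence v ∣B∣ = γ B ≤ γ A = v ∣A∣.
module Submission where

open import Defs
open import Algebra.Properties.IdempotentCommutativeMonoid using (∙-distrˡ-∙)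
open import Data.Bool.Properties using (T-≡)
open import Data.Fin using (Fin; zero; suc)
open import Data.Fin.Properties using (any?)
open import Data.Fin.Subset using (Subset; ⊥; ⁅_⁆; _∈_; _∉_; _⊆_; _∪_; _∩_; ∣_∣; inside; outside)
open import Data.Fin.Subset.Properties
  using (_∈?_; ∉⊥; x∈p∪q⁻; x∈p∩q⁺; p⊆p∪q; q⊆p∪q; x∈⁅y⁆⇒x≡y; drop-there; ⊆-trans; ⊆-antisym;
         ∪-comm; ∪-assoc; ∪-identityˡ; ∪-identityʳ; ∪-idempotentCommutativeMonoid)
open import Data.Nat using (ℕ; zero; suc; _+_; _*_; _≤_; _<_; z≤n; >-nonZero)
open import Data.Nat.Properties
open import Data.Product using (∃; _×_; _,_; proj₁)
open import Data.Sum using (inj₁; inj₂)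
open import Data.Vec using ([]; _∷_; here; there)
open import Data.Vec.Properties using (lookup∘tabulate; []=⇒lookup)
open import Function using (_∘_; Equivalence)
open import Relation.Binary.PropositionalEquality
open import Relation.Nullary using (yes; no; contradiction)
open import Relation.Nullary.Decidable using (_×-dec_; ¬?)

private
  variable
    n : ℕ

∪-lub : {p q r : Subset n} → p ⊆ r → q ⊆ r → p ∪ q ⊆ r
∪-lub {p = p} {q} p⊆r q⊆r x∈p∪q with x∈p∪q⁻ p q x∈p∪q
... | inj₁ x∈p = p⊆r x∈p
... | inj₂ x∈q = q⊆r x∈q

p⊆q⇒p∪q≡q : {p q : Subset n} → p ⊆ q → p ∪ q ≡ q
p⊆q⇒p∪q≡q {p = p} {q} p⊆q = ⊆-antisym (∪-lub p⊆q (λ x∈q → x∈q)) (q⊆p∪q p q)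

x∈p⇒⁅x⁆⊆p : {p : Subset n} {x : Fin n} → x ∈ p → ⁅ x ⁆ ⊆ p
x∈p⇒⁅x⁆⊆p {p = p} {x} x∈p y∈⁅x⁆ = subst (_∈ p) (sym (x∈⁅y⁆⇒x≡y x y∈⁅x⁆)) x∈p

x∈p⇒p∪⁅x⁆≡p : {p : Subset n} {x : Fin n} → x ∈ p → p ∪ ⁅ x ⁆ ≡ p
x∈p⇒p∪⁅x⁆≡p {p = p} {x} x∈p = trans (∪-comm p ⁅ x ⁆) (p⊆q⇒p∪q≡q (x∈p⇒⁅x⁆⊆p x∈p))

∪-distribˡ-∪ : (p q r : Subset n) → p ∪ (q ∪ r) ≡ (p ∪ q) ∪ (p ∪ r)
∪-distribˡ-∪ {n} = ∙-distrˡ-∙ (∪-idempotentCommutativeMonoid n)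

∪⁅⁆-induction : (P : Subset n → Set) (T : Subset n) → P ⊥ →
                (∀ {S x} → x ∈ T → x ∉ S → P S → P (S ∪ ⁅ x ⁆)) → P T

∪⁅⁆-induction-outside : ∀ {b} (P : Subset (suc n) → Set) (T : Subset n) → P ⊥ →
                        (∀ {S x} → x ∈ b ∷ T → x ∉ S → P S → P (S ∪ ⁅ x ⁆)) → P (outside ∷ T)
∪⁅⁆-induction-outside P T base step =
  ∪⁅⁆-induction (P ∘ (outside ∷_)) T base (λ x∈T x∉S → step (there x∈T) (x∉S ∘ drop-there))

∪⁅⁆-induction P []            base step = base
∪⁅⁆-induction P (outside ∷ T) base step = ∪⁅⁆-induction-outside P T base step
∪⁅⁆-induction P (inside ∷ T)  base step =
  subst (λ Z → P (inside ∷ Z)) (∪-identityʳ T) (step here (λ ()) (∪⁅⁆-induction-outside P T base step))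

sumOver-⊥ : (p : Fin n → ℕ) → sumOver p ⊥ ≡ 0
sumOver-⊥ {zero}  p = refl
sumOver-⊥ {suc n} p = sumOver-⊥ (p ∘ suc)

sumOver-∪⁅⁆ : (p : Fin n → ℕ) (S : Subset n) {x : Fin n} → x ∉ S → sumOver p (S ∪ ⁅ x ⁆) ≡ sumOver p S + p x
sumOver-∪⁅⁆ p (outside ∷ S) {zero}  x∉S = begin
  p zero + sumOver (p ∘ suc) (S ∪ ⊥) ≡⟨ cong (λ Z → p zero + sumOver (p ∘ suc) Z) (∪-identityʳ S) ⟩
  p zero + sumOver (p ∘ suc) S       ≡⟨ +-comm (p zero) _ ⟩
  sumOver (p ∘ suc) S + p zero       ∎
  where open ≡-Reasoning
sumOver-∪⁅⁆ p (inside ∷ S)  {zero}  x∉S = contradiction here x∉S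
sumOver-∪⁅⁆ p (outside ∷ S) {suc x} x∉S = sumOver-∪⁅⁆ (p ∘ suc) S (x∉S ∘ there)
sumOver-∪⁅⁆ p (inside ∷ S)  {suc x} x∉S = begin
  p zero + sumOver (p ∘ suc) (S ∪ ⁅ x ⁆) ≡⟨ cong (p zero +_) (sumOver-∪⁅⁆ (p ∘ suc) S (x∉S ∘ there)) ⟩
  p zero + (sumOver (p ∘ suc) S + p (suc x)) ≡⟨ +-assoc (p zero) _ _ ⟨
  p zero + sumOver (p ∘ suc) S + p (suc x) ∎
  where open ≡-Reasoning

sumOver-const : (p : Fin n → ℕ) (v : ℕ) (S : Subset n) → (∀ {x} → x ∈ S → p x ≡ v) → sumOver p S ≡ v * ∣ S ∣
sumOver-const p v []            const = sym (*-zeroʳ v)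
sumOver-const p v (outside ∷ S) const = sumOver-const (p ∘ suc) v S (const ∘ there)
sumOver-const p v (inside ∷ S)  const = begin
  p zero + sumOver (p ∘ suc) S ≡⟨ cong₂ _+_ (const here) (sumOver-const (p ∘ suc) v S (const ∘ there)) ⟩
  v + v * ∣ S ∣                ≡⟨ *-suc v ∣ S ∣ ⟨
  v * suc ∣ S ∣                ∎
  where open ≡-Reasoning

∈ProfitClass⇒≡ : (p : Fin n → ℕ) (v : ℕ) {x : Fin n} → x ∈ ProfitClass p v → p x ≡ v
∈ProfitClass⇒≡ p v {x} x∈P =
  ≡ᵇ⇒≡ (p x) v (Equivalence.from T-≡ (trans (sym (lookup∘tabulate _ x)) ([]=⇒lookup x∈P)))

module _ {γ : Subset n → ℕ}
         (monotone : ∀ A B → A ⊆ B → γ A ≤ γ B)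
         (submodular : ∀ A B → γ (A ∪ B) + γ (A ∩ B) ≤ γ A + γ B) where

  γ-∪⁅⁆≤⇒γ-∪≤ : (A B : Subset n) → (∀ {x} → x ∈ B → γ (A ∪ ⁅ x ⁆) ≤ γ A) → γ (A ∪ B) ≤ γ A
  γ-∪⁅⁆≤⇒γ-∪≤ A B stable = ∪⁅⁆-induction (λ S → γ (A ∪ S) ≤ γ A) B
    (≤-reflexive (cong γ (∪-identityʳ A))) step
    where
    step : ∀ {S x} → x ∈ B → x ∉ S → γ (A ∪ S) ≤ γ A → γ (A ∪ (S ∪ ⁅ x ⁆)) ≤ γ A
    step {S} {x} x∈B _ ih = +-cancelʳ-≤ (γ A) _ _ (begin
      γ (A ∪ (S ∪ ⁅ x ⁆)) + γ A
        ≤⟨ +-monoʳ-≤ (γ (A ∪ (S ∪ ⁅ x ⁆))) (monotone A _ (λ y∈A → x∈p∩q⁺ (p⊆p∪q S y∈A , p⊆p∪q ⁅ x ⁆ y∈A))) ⟩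
      γ (A ∪ (S ∪ ⁅ x ⁆)) + γ ((A ∪ S) ∩ (A ∪ ⁅ x ⁆))
        ≡⟨ cong (λ Z → γ Z + γ ((A ∪ S) ∩ (A ∪ ⁅ x ⁆))) (∪-distribˡ-∪ A S ⁅ x ⁆) ⟩
      γ ((A ∪ S) ∪ (A ∪ ⁅ x ⁆)) + γ ((A ∪ S) ∩ (A ∪ ⁅ x ⁆))
        ≤⟨ submodular (A ∪ S) (A ∪ ⁅ x ⁆) ⟩
      γ (A ∪ S) + γ (A ∪ ⁅ x ⁆)
        ≤⟨ +-mono-≤ ih (stable x∈B) ⟩
      γ A + γ A ∎)
      where open ≤-Reasoning

module _ {p : Fin n → ℕ} {γ : Subset n → ℕ} (H : IsProfitFunction p γ) where
  open IsProfitFunction H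
  open import Algebra.Properties.CommutativeSemigroup +-commutativeSemigroup using (xy∙z≈xz∙y)

  γ-∪⁅⁆-≤ : ∀ A x → γ (A ∪ ⁅ x ⁆) ≤ γ A + p x
  γ-∪⁅⁆-≤ A x with γ-marginal x A
  ... | inj₁ no-gain   = ≤-trans (≤-reflexive no-gain) (+-monoʳ-≤ (γ A) z≤n)
  ... | inj₂ full-gain = ≤-reflexive full-gain

  γ-∪⁅⁆≢⇒≤ : ∀ A x → γ (A ∪ ⁅ x ⁆) ≢ γ A + p x → γ (A ∪ ⁅ x ⁆) ≤ γ A
  γ-∪⁅⁆≢⇒≤ A x ≢full-gain with γ-marginal x A
  ... | inj₁ no-gain   = ≤-reflexive (trans no-gain (+-identityʳ (γ A)))
  ... | inj₂ full-gain = contradiction full-gain ≢full-gain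

  -- The monotonicity of the deficit Σ_S p ∸ γ S, stated without truncated subtraction.
  γ-∪+sumOver≤sumOver-∪+γ : ∀ A T → γ (A ∪ T) + sumOver p A ≤ sumOver p (A ∪ T) + γ A
  γ-∪+sumOver≤sumOver-∪+γ A T = ∪⁅⁆-induction (λ S → γ (A ∪ S) + sumOver p A ≤ sumOver p (A ∪ S) + γ A) T
    base step
    where
    base : γ (A ∪ ⊥) + sumOver p A ≤ sumOver p (A ∪ ⊥) + γ A
    base rewrite ∪-identityʳ A = ≤-reflexive (+-comm (γ A) (sumOver p A))
    extend : ∀ {C x} → γ C + sumOver p A ≤ sumOver p C + γ A →
             γ (C ∪ ⁅ x ⁆) + sumOver p A ≤ sumOver p (C ∪ ⁅ x ⁆) + γ A
    extend {C} {x} ih with x ∈? C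
    ... | yes x∈C rewrite x∈p⇒p∪⁅x⁆≡p x∈C = ih
    ... | no x∉C = begin
      γ (C ∪ ⁅ x ⁆) + sumOver p A  ≤⟨ +-monoˡ-≤ (sumOver p A) (γ-∪⁅⁆-≤ C x) ⟩
      γ C + p x + sumOver p A      ≡⟨ xy∙z≈xz∙y (γ C) (p x) (sumOver p A) ⟩
      γ C + sumOver p A + p x      ≤⟨ +-monoˡ-≤ (p x) ih ⟩
      sumOver p C + γ A + p x      ≡⟨ xy∙z≈xz∙y (sumOver p C) (γ A) (p x) ⟩
      sumOver p C + p x + γ A      ≡⟨ cong (_+ γ A) (sumOver-∪⁅⁆ p C x∉C) ⟨
      sumOver p (C ∪ ⁅ x ⁆) + γ A ∎
      where open ≤-Reasoning
    step : ∀ {S x} → x ∈ T → x ∉ S → γ (A ∪ S) + sumOver p A ≤ sumOver p (A ∪ S) + γ A →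
           γ (A ∪ (S ∪ ⁅ x ⁆)) + sumOver p A ≤ sumOver p (A ∪ (S ∪ ⁅ x ⁆)) + γ A
    step {S} {x} _ _ ih =
      subst (λ Z → γ Z + sumOver p A ≤ sumOver p Z + γ A) (∪-assoc A S ⁅ x ⁆) (extend ih)

  γ≤sumOver : ∀ S → γ S ≤ sumOver p S
  γ≤sumOver S with γ-∪+sumOver≤sumOver-∪+γ ⊥ S
  ... | bound rewrite ∪-identityˡ S | sumOver-⊥ p | γ-empty | +-identityʳ (γ S) | +-identityʳ (sumOver p S) = bound

  Independent-⊆ : ∀ {A B} → A ⊆ B → Independent p γ B → Independent p γ A
  Independent-⊆ {A} {B} A⊆B indB = ≤-antisym (γ≤sumOver A) (+-cancelˡ-≤ (sumOver p B) _ _ (begin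
    sumOver p B + sumOver p A        ≡⟨ cong (_+ sumOver p A) indB ⟨
    γ B + sumOver p A                ≡⟨ cong (λ Z → γ Z + sumOver p A) (p⊆q⇒p∪q≡q A⊆B) ⟨
    γ (A ∪ B) + sumOver p A          ≤⟨ γ-∪+sumOver≤sumOver-∪+γ A B ⟩
    sumOver p (A ∪ B) + γ A          ≡⟨ cong (λ Z → sumOver p Z + γ A) (p⊆q⇒p∪q≡q A⊆B) ⟩
    sumOver p B + γ A                ∎))
    where open ≤-Reasoning

  Independent-∪⁅⁆ : ∀ {A x} → Independent p γ A → x ∉ A → γ (A ∪ ⁅ x ⁆) ≡ γ A + p x →
                    Independent p γ (A ∪ ⁅ x ⁆)
  Independent-∪⁅⁆ {A} {x} indA x∉A full-gain = begin
    γ (A ∪ ⁅ x ⁆)          ≡⟨ full-gain ⟩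
    γ A + p x              ≡⟨ cong (_+ p x) indA ⟩
    sumOver p A + p x      ≡⟨ sumOver-∪⁅⁆ p A x∉A ⟨
    sumOver p (A ∪ ⁅ x ⁆)  ∎
    where open ≡-Reasoning

  module _ {v : ℕ} (v>0 : 0 < v) where

    IndepIn-γ-∪≤⇒∣∣≤ : ∀ {A B} → IndepIn p γ (ProfitClass p v) A → IndepIn p γ (ProfitClass p v) B →
                      γ (A ∪ B) ≤ γ A → ∣ B ∣ ≤ ∣ A ∣
    IndepIn-γ-∪≤⇒∣∣≤ {A} {B} (A⊆P , indA) (B⊆P , indB) γ-∪≤ = *-cancelˡ-≤ v {{>-nonZero v>0}} (begin
      v * ∣ B ∣    ≡⟨ sumOver-const p v B (∈ProfitClass⇒≡ p v ∘ B⊆P) ⟨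
      sumOver p B  ≡⟨ indB ⟨
      γ B          ≤⟨ γ-monotone B (A ∪ B) (q⊆p∪q A B) ⟩
      γ (A ∪ B)    ≤⟨ γ-∪≤ ⟩
      γ A          ≡⟨ indA ⟩
      sumOver p A  ≡⟨ sumOver-const p v A (∈ProfitClass⇒≡ p v ∘ A⊆P) ⟩
      v * ∣ A ∣    ∎)
      where open ≤-Reasoning

    IndepIn-augmentation : ∀ A B → IndepIn p γ (ProfitClass p v) A → IndepIn p γ (ProfitClass p v) B →
                           ∣ A ∣ < ∣ B ∣ → ∃ λ x → x ∈ B × x ∉ A × IndepIn p γ (ProfitClass p v) (A ∪ ⁅ x ⁆)
    IndepIn-augmentation A B indInA@(A⊆P , indA) indInB@(B⊆P , _) ∣A∣<∣B∣
      with any? (λ x → x ∈? B ×-dec ¬? (x ∈? A) ×-dec γ (A ∪ ⁅ x ⁆) ≟ γ A + p x)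
    ... | yes (x , x∈B , x∉A , full-gain) =
      x , x∈B , x∉A , ∪-lub A⊆P (x∈p⇒⁅x⁆⊆p (B⊆P x∈B)) , Independent-∪⁅⁆ indA x∉A full-gain
    ... | no no-full-gain = contradiction
      (IndepIn-γ-∪≤⇒∣∣≤ indInA indInB (γ-∪⁅⁆≤⇒γ-∪≤ γ-monotone γ-submodular A B no-gain))
      (<⇒≱ ∣A∣<∣B∣)
      where
      no-gain : ∀ {x} → x ∈ B → γ (A ∪ ⁅ x ⁆) ≤ γ A
      no-gain {x} x∈B with x ∈? A
      ... | yes x∈A = ≤-reflexive (cong γ (x∈p⇒p∪⁅x⁆≡p x∈A))
      ... | no x∉A  = γ-∪⁅⁆≢⇒≤ A x (λ full-gain → no-full-gain (x , x∈B , x∉A , full-gain))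

lemma4 : ∀ (n : ℕ) (p : Fin n → ℕ) (γ : Subset n → ℕ) → IsProfitFunction p γ →
         ∀ (v : ℕ) → (∃ λ i → p i ≡ v) →
         IsMatroid (ProfitClass p v) (IndepIn p γ (ProfitClass p v))
lemma4 n p γ H v (i , pᵢ≡v) = record
  { within-ground = λ _ → proj₁
  ; empty-indep   = (λ x∈⊥ → contradiction x∈⊥ ∉⊥) , trans γ-empty (sym (sumOver-⊥ p))
  ; hereditary    = λ A B A⊆B (B⊆P , indB) → ⊆-trans A⊆B B⊆P , Independent-⊆ H A⊆B indB
  ; augmentation  = IndepIn-augmentation H (subst (0 <_) pᵢ≡v (profit-pos i))
  }
  where open IsProfitFunction H
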